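{- For every lambda-term $t$ we have $[\![T_{ -\eta}]\!](t)=[\![T'_{ -\eta}]\!](t)$ (syntactic identity).
   Context: Lambda-terms are considered up to $\alpha$-equivalence; $\mathrm{FV}(t)$ is the set of free variables of $t$. Fix the closed lambda-terms (combinators) $\mathsf{S}=\lambda xyz.xz(yz)$, $\mathsf{K}=\lambda xy.x$, $\mathsf{I}=\lambda x.x$, $\mathsf{B}=\lambda xyz.x(yz)$, $\mathsf{C}=\lambda xyz.xzy$, $\mathsf{S}'=\lambda kxyz.k(xz)(yz)$, $\mathsf{B}'=\lambda kxyz.kx(yz)$, $\mathsf{C}'=\lambda kxyz.k(xz)y$. Let $\mathcal{B}=\{\mathsf{S},\mathsf{K},\mathsf{I},\mathsf{B},\mathsf{C},\mathsf{S}',\mathsf{B}',\mathsf{C}'\}$ and let $\mathrm{CL}(\mathcal{B})$ be the set of terms built from variables and elements of $\mathcal{B}$ using only application (left-associative). Equality of such terms is syntactic identity, combinators treated as atoms. Algorithm $T_{ -\eta}$: for a variable $x$ and $t\in\mathrm{CL}(\mathcal{B})$, $[x]_{T_{ -\eta}} t$ (written $[x]t$ below) is given by the first applicable equation: (1) $[x]t=\mathsf{K}t$ if $x\notin\mathrm{FV}(t)$; (2) $[x]x=\mathsf{I}$; (6) $[x](u s t)=\mathsf{B}'us([x]t)$ if $x\notin\mathrm{FV}(us)$; (7) $[x](u s t)=\mathsf{C}'u([x]s)t$ if $x\notin\mathrm{FV}(ut)$; (8) $[x](u s t)=\mathsf{S}'u([x]s)([x]t)$ if $x\notin\mathrm{FV}(u)$;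 (9) $[x](s t)=\mathsf{B}s([x]t)$ if $x\notin\mathrm{FV}(s)$; (10) $[x](s t)=\mathsf{C}([x]s)t$ if $x\notin\mathrm{FV}(t)$; (11) $[x](s t)=\mathsf{S}([x]s)([x]t)$. Algorithm $T'_{ -\eta}$: $[x](st)=\mathrm{Opt}(\mathsf{S}([x]s)([x]t))$; $[x]x=\mathsf{I}$; $[x]t=\mathsf{K}t$ otherwise (for $t$ a variable other than $x$ or a constant), earlier equations taking precedence, where $\mathrm{Opt}$ is given by the first applicable clause: $\mathrm{Opt}(\mathsf{S}(\mathsf{K}s)(\mathsf{K}t))=\mathsf{K}(st)$; $\mathrm{Opt}(\mathsf{S}(\mathsf{K}(us))t)=\mathsf{B}'ust$; $\mathrm{Opt}(\mathsf{S}(\mathsf{K}s)t)=\mathsf{B}st$; $\mathrm{Opt}(\mathsf{S}(\mathsf{B}us)(\mathsf{K}t))=\mathsf{C}'ust$; $\mathrm{Opt}(\mathsf{S}(\mathsf{B}'u_1u_2s)(\mathsf{K}t))=\mathsf{C}'(u_1u_2)st$; $\mathrm{Opt}(\mathsf{S}s(\mathsf{K}t))=\mathsf{C}st$; $\mathrm{Opt}(\mathsf{S}(\mathsf{B}us)t)=\mathsf{S}'ust$; $\mathrm{Opt}(\mathsf{S}(\mathsf{B}'u_1u_2s)t)=\mathsf{S}'(u_1u_2)st$; $\mathrm{Opt}(\mathsf{S}st)=\mathsf{S}st$. For an abstraction algorithm $A$ the induced translation $[\![A]\!]$ from lambda-terms to $\mathrm{CL}(\mathcal{B})$ is defined by $[\![A]\!](x)=x$,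 $[\![A]\!](st)=[\![A]\!](s)\,[\![A]\!](t)$, $[\![A]\!](\lambda x.t)=[x]_A([\![A]\!](t))$. -}

module Defs where

open import Data.Nat using (ℕ; _≡ᵇ_)
open import Data.Bool using (Bool; true; false; if_then_else_; _∨_; not)

data Λ : Set where
  var : ℕ → Λ
  ap  : Λ → Λ → Λ
  lam : ℕ → Λ → Λ

data Comb : Set where
  S K I B C S′ B′ C′ : Comb

data CL : Set where
  v   : ℕ → CL
  c   : Comb → CL
  _·_ : CL → CL → CL

infixl 9 _·_

occurs : ℕ → CL → Bool
occurs x (v y)   = x ≡ᵇ y
occurs x (c _)   = false
occurs x (s · t) = occurs x s ∨ occurs x t

mutual
  absT : ℕ → CL → CL
  absT x t = if occurs x t then absT-occ x t else c K · t

  -- t contains x free (rule (1) does not apply)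
  absT-occ : ℕ → CL → CL
  absT-occ x (v y) = c I                       -- rule (2): y = x
  absT-occ x (c k) = c K · c k                 -- unreachable
  absT-occ x ((u · s) · t) =
    if not (occurs x (u · s)) then c B′ · u · s · absT x t
    else if not (occurs x u ∨ occurs x t) then c C′ · u · absT x s · t
    else if not (occurs x u) then c S′ · u · absT x s · absT x t
    else absT-app x (u · s) t
  absT-occ x (v y · t) = absT-app x (v y) t
  absT-occ x (c k · t) = absT-app x (c k) t

  absT-app : ℕ → CL → CL → CL
  absT-app x s t =
    if not (occurs x s) then c B · s · absT x t
    else if not (occurs x t) then c C · absT x s · t
    else c S · absT x s · absT x t

opt : CL → CL → CL
opt (c K · s) (c K · t) = c K · (s · t)
opt (c K · (u · s)) t = c B′ · u · s · t
opt (c K · s) t = c B · s · t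
opt (c B · u · s) (c K · t) = c C′ · u · s · t
opt (c B′ · u₁ · u₂ · s) (c K · t) = c C′ · (u₁ · u₂) · s · t
opt s (c K · t) = c C · s · t
opt (c B · u · s) t = c S′ · u · s · t
opt (c B′ · u₁ · u₂ · s) t = c S′ · (u₁ · u₂) · s · t
opt s t = c S · s · t

absT′ : ℕ → CL → CL
absT′ x (s · t) = opt (absT′ x s) (absT′ x t)
absT′ x (v y) = if x ≡ᵇ y then c I else c K · v y
absT′ x (c k) = c K · c k

⟦T⟧ : Λ → CL
⟦T⟧ (var x)   = v x
⟦T⟧ (ap s t)  = ⟦T⟧ s · ⟦T⟧ t
⟦T⟧ (lam x t) = absT x (⟦T⟧ t)

⟦T′⟧ : Λ → CL
⟦T′⟧ (var x)   = v x
⟦T′⟧ (ap s t)  = ⟦T′⟧ s · ⟦T′⟧ t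
⟦T′⟧ (lam x t) = absT′ x (⟦T′⟧ t)

-- T′_{-η} is compositional: [x](s t) = Opt(S ([x]s) ([x]t)).  So it suffices to
-- show that T_{-η} obeys the same recursion (absT-·-opt).  If x ∉ FV(t) both give
-- K t; otherwise [x]t is I or an application to at least two arguments, hence never
-- K t, and if x also occurs in the head u of t = u s it is not of the form B u s or
-- B′ u₁ u₂ s either.  Given these shapes, the first applicable Opt clause is exactly
-- the rule among (1), (6)–(11) selected by which of the subterms contain x.

module Submission where

open import Data.Bool using (true; false)
open import Data.Nat using (_≡ᵇ_)
open import Relation.Binary.PropositionalEquality using (_≡_; refl; sym; trans; cong; cong₂)

open import Defs

-- Syntactic shapes, chosen so that opt computes on them, which exclude K t
-- (NonK) and also B u s, B′ u₁ u₂ s (NonKB).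

data NonK : CL → Set where
  I-head : NonK (c I)
  binary : ∀ p q r → NonK (p · q · r)

data NonKB : CL → Set where
  I-head  : NonKB (c I)
  C-head  : ∀ a b → NonKB (c C · a · b)
  S-head  : ∀ a b → NonKB (c S · a · b)
  C′-head : ∀ a b d → NonKB (c C′ · a · b · d)
  S′-head : ∀ a b d → NonKB (c S′ · a · b · d)

data Atom : CL → Set where
  var : ∀ y → Atom (v y)
  con : ∀ k → Atom (c k)

opt-B′ : ∀ u s {r} → NonK r → opt (c K · (u · s)) r ≡ c B′ · u · s · r
opt-B′ u s I-head         = refl
opt-B′ u s (binary p q r) = refl

opt-B : ∀ {s r} → Atom s → NonK r → opt (c K · s) r ≡ c B · s · r
opt-B (var y) I-head         = refl
opt-B (var y) (binary p q r) = refl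
opt-B (con k) I-head         = refl
opt-B (con k) (binary p q r) = refl

opt-C : ∀ {l} t → NonKB l → opt l (c K · t) ≡ c C · l · t
opt-C t I-head          = refl
opt-C t (C-head a b)    = refl
opt-C t (S-head a b)    = refl
opt-C t (C′-head a b d) = refl
opt-C t (S′-head a b d) = refl

opt-S′-B : ∀ u s {r} → NonK r → opt (c B · u · s) r ≡ c S′ · u · s · r
opt-S′-B u s I-head         = refl
opt-S′-B u s (binary p q r) = refl

opt-S′-B′ : ∀ u₁ u₂ s {r} → NonK r → opt (c B′ · u₁ · u₂ · s) r ≡ c S′ · (u₁ · u₂) · s · r
opt-S′-B′ u₁ u₂ s I-head         = refl
opt-S′-B′ u₁ u₂ s (binary p q r) = refl

opt-S : ∀ {l r} → NonKB l → NonK r → opt l r ≡ c S · l · r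
opt-S I-head          I-head         = refl
opt-S I-head          (binary p q r) = refl
opt-S (C-head a b)    I-head         = refl
opt-S (C-head a b)    (binary p q r) = refl
opt-S (S-head a b)    I-head         = refl
opt-S (S-head a b)    (binary p q r) = refl
opt-S (C′-head a b d) I-head         = refl
opt-S (C′-head a b d) (binary p q r) = refl
opt-S (S′-head a b d) I-head         = refl
opt-S (S′-head a b d) (binary p q r) = refl

absT-app-NonK : ∀ x s t → NonK (absT-app x s t)
absT-app-NonK x s t with occurs x s | occurs x t
... | false | _     = binary _ _ _
... | true  | false = binary _ _ _
... | true  | true  = binary _ _ _

absT-occ-NonK : ∀ x t → occurs x t ≡ true → NonK (absT-occ x t)
absT-occ-NonK x (v y)         _ = I-head
absT-occ-NonK x (v y · t)     _ = absT-app-NonK x (v y) t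
absT-occ-NonK x (c k · t)     _ = absT-app-NonK x (c k) t
absT-occ-NonK x ((u · s) · t) _ with occurs x u | occurs x s | occurs x t
... | false | false | _     = binary _ _ _
... | false | true  | false = binary _ _ _
... | false | true  | true  = binary _ _ _
... | true  | _     | false = binary _ _ _
... | true  | _     | true  = binary _ _ _

absT-app-NonKB : ∀ x s t → occurs x s ≡ true → NonKB (absT-app x s t)
absT-app-NonKB x s t x∈s rewrite x∈s with occurs x t
... | false = C-head _ _
... | true  = S-head _ _

absT-occ-NonKB : ∀ x u s → occurs x u ≡ true → NonKB (absT-occ x (u · s))
absT-occ-NonKB x (v y)     s x∈u = absT-app-NonKB x (v y) s x∈u
absT-occ-NonKB x (u₁ · u₂) s x∈u with occurs x u₁ | occurs x u₂ | occurs x s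
... | false | true  | false = C′-head _ _ _
... | false | true  | true  = S′-head _ _ _
... | true  | _     | false = C-head _ _
... | true  | _     | true  = S-head _ _

opt-absT-occ-K : ∀ x u s t → occurs x u ≡ false → occurs x s ≡ true →
                 opt (absT-occ x (u · s)) (c K · t) ≡ c C′ · u · absT-occ x s · t
opt-absT-occ-K x (v y)     s t x∉u x∈s rewrite x∉u | x∈s = refl
opt-absT-occ-K x (c k)     s t x∉u x∈s rewrite x∈s       = refl
opt-absT-occ-K x (u₁ · u₂) s t x∉u x∈s rewrite x∉u | x∈s = refl

opt-absT-occ-NonK : ∀ x u s {r} → occurs x u ≡ false → occurs x s ≡ true → NonK r →
                    opt (absT-occ x (u · s)) r ≡ c S′ · u · absT-occ x s · r
opt-absT-occ-NonK x (v y)     s x∉u x∈s r rewrite x∉u | x∈s = opt-S′-B (v y) _ r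
opt-absT-occ-NonK x (c k)     s x∉u x∈s r rewrite x∈s       = opt-S′-B (c k) _ r
opt-absT-occ-NonK x (u₁ · u₂) s x∉u x∈s r rewrite x∉u | x∈s = opt-S′-B′ u₁ u₂ _ r

absT-·-opt : ∀ x s t → absT x (s · t) ≡ opt (absT x s) (absT x t)
absT-·-opt x (v y) t with x ≡ᵇ y | occurs x t in x∈t
... | true  | true  = sym (opt-S I-head (absT-occ-NonK x t x∈t))
... | true  | false = refl
... | false | true  = sym (opt-B (var y) (absT-occ-NonK x t x∈t))
... | false | false = refl
absT-·-opt x (c k) t with occurs x t in x∈t
... | true  = sym (opt-B (con k) (absT-occ-NonK x t x∈t))
... | false = refl
absT-·-opt x (u · s) t with occurs x u in x∈u | occurs x s in x∈s | occurs x t in x∈t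
... | false | false | false = refl
... | false | false | true  = sym (opt-B′ u s (absT-occ-NonK x t x∈t))
... | false | true  | false = sym (opt-absT-occ-K x u s t x∈u x∈s)
... | false | true  | true  = sym (opt-absT-occ-NonK x u s x∈u x∈s (absT-occ-NonK x t x∈t))
... | true  | _     | false = sym (opt-C t (absT-occ-NonKB x u s x∈u))
... | true  | _     | true  = sym (opt-S (absT-occ-NonKB x u s x∈u) (absT-occ-NonK x t x∈t))

absT≡absT′ : ∀ x t → absT x t ≡ absT′ x t
absT≡absT′ x (v y)   = refl
absT≡absT′ x (c k)   = refl
absT≡absT′ x (s · t) = trans (absT-·-opt x s t) (cong₂ opt (absT≡absT′ x s) (absT≡absT′ x t))

mainTheorem3 : (t : Λ) → ⟦T⟧ t ≡ ⟦T′⟧ t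
mainTheorem3 (var x)   = refl
mainTheorem3 (ap s t)  = cong₂ _·_ (mainTheorem3 s) (mainTheorem3 t)
mainTheorem3 (lam x t) = trans (cong (absT x) (mainTheorem3 t)) (absT≡absT′ x (⟦T′⟧ t))
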